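{- Every formula of $\mathcal{L}(\Rightarrow)$ is provably equivalent in the Yalcin logic to a formula of $\mathcal{L}$; that is, for every $\varphi\in\mathcal{L}(\Rightarrow)$ there is $\varphi'\in\mathcal{L}$ such that $\varphi\leftrightarrow\varphi'$ is a theorem of the Yalcin logic.
   Context: The language $\mathcal{L}(\Rightarrow)$ is given by $\varphi::= p\mid \neg\varphi\mid (\varphi\wedge\varphi)\mid \Box\varphi \mid (\varphi\Rightarrow\varphi)$ over a fixed set of propositional variables; $\vee,\to,\leftrightarrow,\bot$ are defined as usual and $\Diamond\varphi:=\neg\Box\neg\varphi$. $\mathcal{L}$ is the set of formulas not containing $\Rightarrow$. A formula is nonmodal if it contains neither $\Box$ nor $\Rightarrow$. The Yalcin logic is the smallest set of formulas closed under replacement of equivalents (if $\alpha\leftrightarrow\beta$ is in the set and $\varphi'$ results from $\varphi$ by replacing an occurrence of $\alpha$ by $\beta$, then $\varphi\leftrightarrow\varphi'$ is in the set), modus ponens for $\to$, and necessitation (from $\varphi$ infer $\Box\varphi$), and containing all substitution instances of propositional tautologies and all instances (for arbitrary formulas $\varphi,\psi,\alpha,\beta$ and nonmodal $\pi$) of: K: $\Box(\varphi\to\psi)\to(\Box\varphi\to\Box\psi)$; 4: $\Diamond\Diamond\varphi\to\Diamond\varphi$; 5: $\Diamond\Box\varphi\to\Box\varphi$; I1: $(\varphi\Rightarrow\pi)\leftrightarrow\Box(\varphi\to\pi)$; I2: $(\varphi\Rightarrow(\alpha\wedge\beta))\leftrightarrow((\varphi\Rightarrow\alpha)\wedge(\varphi\Rightarrow\beta))$;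 I3: $(\varphi\Rightarrow\alpha)\to(\varphi\Rightarrow(\alpha\vee\beta))$; I4: $(\varphi\Rightarrow\alpha)\to(\varphi\Rightarrow\Box\alpha)$; I5: $((\varphi\Rightarrow(\alpha\vee\Box\beta))\wedge\neg(\varphi\Rightarrow\beta))\to(\varphi\Rightarrow\alpha)$; I6: $((\varphi\Rightarrow(\alpha\vee\Diamond\beta))\wedge(\varphi\Rightarrow\neg\beta))\to(\varphi\Rightarrow\alpha)$; I7: $\neg(\varphi\Rightarrow\beta)\to(\varphi\Rightarrow\Diamond\neg\beta)$. -}

module Defs where

open import Data.Bool using (Bool; true; false; not; _∧_)
open import Data.Product using (Σ; _×_; _,_)
open import Relation.Binary.PropositionalEquality using (_≡_)

data Fm (V : Set) : Set where
  var  : V → Fm V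
  ¬'_  : Fm V → Fm V
  _∧'_ : Fm V → Fm V → Fm V
  □_   : Fm V → Fm V
  _⇒_  : Fm V → Fm V → Fm V

infixr 6 _∧'_
infixr 3 _⇒_
infix  8 ¬'_ □_

module _ {V : Set} where
  infixr 5 _∨'_
  infixr 4 _→'_ _↔'_
  infix  8 ◇_
  _∨'_ : Fm V → Fm V → Fm V
  φ ∨' ψ = ¬' (¬' φ ∧' ¬' ψ)

  _→'_ : Fm V → Fm V → Fm V
  φ →' ψ = ¬' (φ ∧' ¬' ψ)

  _↔'_ : Fm V → Fm V → Fm V
  φ ↔' ψ = (φ →' ψ) ∧' (ψ →' φ)

  ◇_ : Fm V → Fm V
  ◇ φ = ¬' □ ¬' φ

  data Nonmodal : Fm V → Set where
    nm-var : ∀ p → Nonmodal (var p)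
    nm-¬   : ∀ {φ} → Nonmodal φ → Nonmodal (¬' φ)
    nm-∧   : ∀ {φ ψ} → Nonmodal φ → Nonmodal ψ → Nonmodal (φ ∧' ψ)

  data InL : Fm V → Set where
    L-var : ∀ p → InL (var p)
    L-¬   : ∀ {φ} → InL φ → InL (¬' φ)
    L-∧   : ∀ {φ ψ} → InL φ → InL ψ → InL (φ ∧' ψ)
    L-□   : ∀ {φ} → InL φ → InL (□ φ)

  evalP : (Fm V → Bool) → Fm V → Bool
  evalP v (var p)  = v (var p)
  evalP v (¬' φ)   = not (evalP v φ)
  evalP v (φ ∧' ψ) = evalP v φ ∧ evalP v ψ
  evalP v (□ φ)    = v (□ φ)
  evalP v (φ ⇒ ψ)  = v (φ ⇒ ψ)

  -- substitution instance of a propositional tautology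
  Taut : Fm V → Set
  Taut φ = (v : Fm V → Bool) → evalP v φ ≡ true

  data Replace (α β : Fm V) : Fm V → Fm V → Set where
    here : Replace α β α β
    in¬  : ∀ {φ φ'} → Replace α β φ φ' → Replace α β (¬' φ) (¬' φ')
    in∧ˡ : ∀ {φ φ' ψ} → Replace α β φ φ' → Replace α β (φ ∧' ψ) (φ' ∧' ψ)
    in∧ʳ : ∀ {φ ψ ψ'} → Replace α β ψ ψ' → Replace α β (φ ∧' ψ) (φ ∧' ψ')
    in□  : ∀ {φ φ'} → Replace α β φ φ' → Replace α β (□ φ) (□ φ')
    in⇒ˡ : ∀ {φ φ' ψ} → Replace α β φ φ' → Replace α β (φ ⇒ ψ) (φ' ⇒ ψ)
    in⇒ʳ : ∀ {φ ψ ψ'} → Replace α β ψ ψ' → Replace α β (φ ⇒ ψ) (φ ⇒ ψ')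

  data ⊢Y_ : Fm V → Set where
    taut : ∀ {φ} → Taut φ → ⊢Y φ
    axK  : ∀ φ ψ → ⊢Y (□ (φ →' ψ) →' (□ φ →' □ ψ))
    ax4  : ∀ φ → ⊢Y (◇ ◇ φ →' ◇ φ)
    ax5  : ∀ φ → ⊢Y (◇ □ φ →' □ φ)
    axI1 : ∀ φ π → Nonmodal π → ⊢Y ((φ ⇒ π) ↔' □ (φ →' π))
    axI2 : ∀ φ α β → ⊢Y ((φ ⇒ (α ∧' β)) ↔' ((φ ⇒ α) ∧' (φ ⇒ β)))
    axI3 : ∀ φ α β → ⊢Y ((φ ⇒ α) →' (φ ⇒ (α ∨' β)))
    axI4 : ∀ φ α → ⊢Y ((φ ⇒ α) →' (φ ⇒ □ α))
    axI5 : ∀ φ α β → ⊢Y (((φ ⇒ (α ∨' □ β)) ∧' ¬' (φ ⇒ β)) →' (φ ⇒ α))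
    axI6 : ∀ φ α β → ⊢Y (((φ ⇒ (α ∨' ◇ β)) ∧' (φ ⇒ ¬' β)) →' (φ ⇒ α))
    axI7 : ∀ φ β → ⊢Y (¬' (φ ⇒ β) →' (φ ⇒ ◇ ¬' β))
    re   : ∀ {α β φ φ'} → ⊢Y (α ↔' β) → Replace α β φ φ' → ⊢Y (φ ↔' φ')
    mp   : ∀ {φ ψ} → ⊢Y (φ →' ψ) → ⊢Y φ → ⊢Y ψ
    nec  : ∀ {φ} → ⊢Y φ → ⊢Y (□ φ)

  infix 2 ⊢Y_

-- The theorem is proved by induction on φ; all connectives except ⇒ are
-- handled by replacement of equivalents, so everything rests on the case
-- a ⇒ χ with a, χ already in L.  For a fixed antecedent a ∈ L, call F
-- "expressible" when a ⇒ F is provably equivalent to a formula of L.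
--   * If π is nonmodal, F = π is expressible by I1.
--   * Expressibility is closed under ∧ (by I2), under F ↦ F ∨ □χ when χ is
--     expressible (by I3–I5) and under F ↦ F ∨ ◇β when ¬β is expressible
--     (by I3, I6, I7).
-- Expressibility of an arbitrary χ ∈ L then follows by a clause-by-clause
-- normalisation, organised in continuation-passing style: a "reducible"
-- residue R is one for which π ∨ R is expressible for every nonmodal π,
-- and one shows that c ∨ R and ¬c ∨ R are reducible for every c ∈ L,
-- recursing on c and moving literals into π.  Finally χ ↔ ⊥ ∨ (χ ∨ ⊥).
--
-- Purely propositional steps are instances of tautology schemas, whose
-- validity is checked by evaluating on all Boolean assignments.

module Submission where

open import Defs
open import Data.Bool using (Bool; true; false; not; T) renaming (_∧_ to _and_)
open import Data.Bool.Properties using (T-∧; T-≡)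
open import Data.Nat using (ℕ; zero; suc)
open import Data.Fin using (Fin; zero; suc)
open import Data.Product using (Σ; _×_; _,_; proj₁; proj₂)
open import Data.Vec using (Vec; []; _∷_; lookup; map)
open import Data.Vec.Properties using (lookup-map)
open import Function.Bundles using (Equivalence)
open import Relation.Binary.PropositionalEquality using (_≡_; refl; sym; trans; cong; cong₂)

open Equivalence using (to)

data Schema (n : ℕ) : Set where
  `_  : Fin n → Schema n
  ~_  : Schema n → Schema n
  _&_ : Schema n → Schema n → Schema n

infixr 6 _&_
infix  8 ~_ `_
infixr 5 _∨ₛ_
infixr 4 _⊃_ _≡ₛ_

_∨ₛ_ _⊃_ _≡ₛ_ : ∀ {n} → Schema n → Schema n → Schema n
s ∨ₛ t = ~ (~ s & ~ t)
s ⊃ t  = ~ (s & ~ t)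
s ≡ₛ t = (s ⊃ t) & (t ⊃ s)

pattern x₀ = ` zero
pattern x₁ = ` suc zero
pattern x₂ = ` suc (suc zero)
pattern x₃ = ` suc (suc (suc zero))
pattern x₄ = ` suc (suc (suc (suc zero)))
pattern x₅ = ` suc (suc (suc (suc (suc zero))))

evalₛ : ∀ {n} → Vec Bool n → Schema n → Bool
evalₛ ρ (` i)   = lookup ρ i
evalₛ ρ (~ s)   = not (evalₛ ρ s)
evalₛ ρ (s & t) = evalₛ ρ s and evalₛ ρ t

_[_] : ∀ {n} {V : Set} → Schema n → Vec (Fm V) n → Fm V
(` i) [ σ ]   = lookup σ i
(~ s) [ σ ]   = ¬' (s [ σ ])
(s & t) [ σ ] = (s [ σ ]) ∧' (t [ σ ])

evalP-instance : ∀ {n} {V : Set} (v : Fm V → Bool) (σ : Vec (Fm V) n) (s : Schema n) →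
                 evalP v (s [ σ ]) ≡ evalₛ (map (evalP v) σ) s
evalP-instance v σ (` i)   = sym (lookup-map i (evalP v) σ)
evalP-instance v σ (~ s)   = cong not (evalP-instance v σ s)
evalP-instance v σ (s & t) = cong₂ _and_ (evalP-instance v σ s) (evalP-instance v σ t)

allAssignments : (n : ℕ) → (Vec Bool n → Bool) → Bool
allAssignments zero    f = f []
allAssignments (suc n) f =
  allAssignments n (λ ρ → f (true ∷ ρ)) and allAssignments n (λ ρ → f (false ∷ ρ))

allAssignments-sound : ∀ n (f : Vec Bool n → Bool) → T (allAssignments n f) → ∀ ρ → T (f ρ)
allAssignments-sound zero    f h []          = h
allAssignments-sound (suc n) f h (true ∷ ρ)  = allAssignments-sound n _ (proj₁ (to T-∧ h)) ρ
allAssignments-sound (suc n) f h (false ∷ ρ) = allAssignments-sound n _ (proj₂ (to T-∧ h)) ρ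

valid : ∀ {n} → Schema n → Bool
valid {n} s = allAssignments n (λ ρ → evalₛ ρ s)

tautology : ∀ {n} {V : Set} (s : Schema n) → T (valid s) → (σ : Vec (Fm V) n) → ⊢Y (s [ σ ])
tautology {n} s ok σ =
  taut (λ v → trans (evalP-instance v σ s)
                    (to T-≡ (allAssignments-sound n (λ ρ → evalₛ ρ s) ok (map (evalP v) σ))))

-- Modus ponens written as application, so that a schema can be fed its premises.
infixl 4 _·_
_·_ : ∀ {V : Set} {φ ψ : Fm V} → ⊢Y (φ →' ψ) → ⊢Y φ → ⊢Y ψ
_·_ = mp

module _ {V : Set} where

  ↔-refl : (A : Fm V) → ⊢Y (A ↔' A)
  ↔-refl A = tautology (x₀ ≡ₛ x₀) _ (A ∷ [])

  ↔-trans : {A B C : Fm V} → ⊢Y (A ↔' B) → ⊢Y (B ↔' C) → ⊢Y (A ↔' C)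
  ↔-trans {A} {B} {C} A↔B B↔C =
    tautology ((x₀ ≡ₛ x₁) ⊃ (x₁ ≡ₛ x₂) ⊃ (x₀ ≡ₛ x₂)) _ (A ∷ B ∷ C ∷ []) · A↔B · B↔C

  ↔-cong-∧ : {A A' B B' : Fm V} → ⊢Y (A ↔' A') → ⊢Y (B ↔' B') → ⊢Y ((A ∧' B) ↔' (A' ∧' B'))
  ↔-cong-∧ {A} {A'} {B} {B'} eA eB =
    tautology ((x₀ ≡ₛ x₁) ⊃ (x₂ ≡ₛ x₃) ⊃ ((x₀ & x₂) ≡ₛ (x₁ & x₃))) _ (A ∷ A' ∷ B ∷ B' ∷ []) · eA · eB

  ↔-cong-∨ : {A A' B B' : Fm V} → ⊢Y (A ↔' A') → ⊢Y (B ↔' B') → ⊢Y ((A ∨' B) ↔' (A' ∨' B'))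
  ↔-cong-∨ {A} {A'} {B} {B'} eA eB =
    tautology ((x₀ ≡ₛ x₁) ⊃ (x₂ ≡ₛ x₃) ⊃ ((x₀ ∨ₛ x₂) ≡ₛ (x₁ ∨ₛ x₃))) _ (A ∷ A' ∷ B ∷ B' ∷ []) · eA · eB

  ¬¬-intro : (A : Fm V) → ⊢Y (A ↔' ¬' ¬' A)
  ¬¬-intro A = tautology (x₀ ≡ₛ ~ ~ x₀) _ (A ∷ [])

  ¬¬-elim : (A : Fm V) → ⊢Y (¬' ¬' A ↔' A)
  ¬¬-elim A = tautology (~ ~ x₀ ≡ₛ x₀) _ (A ∷ [])

  nonmodal-InL : {π : Fm V} → Nonmodal π → InL π
  nonmodal-InL (nm-var p)  = L-var p
  nonmodal-InL (nm-¬ h)    = L-¬ (nonmodal-InL h)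
  nonmodal-InL (nm-∧ h k)  = L-∧ (nonmodal-InL h) (nonmodal-InL k)

  InL-∨ : {A B : Fm V} → InL A → InL B → InL (A ∨' B)
  InL-∨ a b = L-¬ (L-∧ (L-¬ a) (L-¬ b))

  Nonmodal-∨ : {A B : Fm V} → Nonmodal A → Nonmodal B → Nonmodal (A ∨' B)
  Nonmodal-∨ a b = nm-¬ (nm-∧ (nm-¬ a) (nm-¬ b))

  -- Some variable occurring in a formula (used to build a nonmodal ⊥).
  someVar : Fm V → V
  someVar (var p)  = p
  someVar (¬' φ)   = someVar φ
  someVar (φ ∧' ψ) = someVar φ
  someVar (□ φ)    = someVar φ
  someVar (φ ⇒ ψ)  = someVar φ

module Antecedent {V : Set} (a : Fm V) where

  Expressible : Fm V → Set
  Expressible F = Σ (Fm V) (λ r → InL r × ⊢Y ((a ⇒ F) ↔' r))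

  ⇒-congʳ : {F G : Fm V} → ⊢Y (F ↔' G) → ⊢Y ((a ⇒ F) ↔' (a ⇒ G))
  ⇒-congʳ F↔G = re F↔G (in⇒ʳ here)

  expressible-cong : {F G : Fm V} → ⊢Y (F ↔' G) → Expressible G → Expressible F
  expressible-cong F↔G (r , rL , e) = r , rL , ↔-trans (⇒-congʳ F↔G) e

  expressible-∧ : {F G : Fm V} → Expressible F → Expressible G → Expressible (F ∧' G)
  expressible-∧ {F} {G} (r , rL , e) (s , sL , f) =
    r ∧' s , L-∧ rL sL , ↔-trans (axI2 a F G) (↔-cong-∧ e f)

  ⇒-split-□ : (α β : Fm V) → ⊢Y ((a ⇒ (α ∨' □ β)) ↔' ((a ⇒ α) ∨' (a ⇒ β)))
  ⇒-split-□ α β =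
    tautology (((x₀ & ~ x₂) ⊃ x₁) ⊃ (x₁ ⊃ x₀) ⊃ (x₂ ⊃ x₃) ⊃ (x₃ ⊃ x₄) ⊃ (x₄ ≡ₛ x₀)
                 ⊃ (x₀ ≡ₛ (x₁ ∨ₛ x₂))) _
      ((a ⇒ (α ∨' □ β)) ∷ (a ⇒ α) ∷ (a ⇒ β) ∷ (a ⇒ □ β) ∷ (a ⇒ (□ β ∨' α)) ∷ [])
    · axI5 a α β · axI3 a α (□ β) · axI4 a β · axI3 a (□ β) α
    · ⇒-congʳ (tautology ((x₀ ∨ₛ x₁) ≡ₛ (x₁ ∨ₛ x₀)) _ (□ β ∷ α ∷ []))

  ⇒-split-◇ : (α β : Fm V) → ⊢Y ((a ⇒ (α ∨' ◇ β)) ↔' ((a ⇒ α) ∨' ¬' (a ⇒ ¬' β)))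
  ⇒-split-◇ α β =
    tautology (((x₀ & x₂) ⊃ x₁) ⊃ (x₁ ⊃ x₀) ⊃ (~ x₂ ⊃ x₃) ⊃ (x₃ ≡ₛ x₄) ⊃ (x₄ ⊃ x₅)
                 ⊃ (x₅ ≡ₛ x₀) ⊃ (x₀ ≡ₛ (x₁ ∨ₛ ~ x₂))) _
      ((a ⇒ (α ∨' ◇ β)) ∷ (a ⇒ α) ∷ (a ⇒ ¬' β) ∷ (a ⇒ ◇ ¬' ¬' β) ∷ (a ⇒ ◇ β)
         ∷ (a ⇒ (◇ β ∨' α)) ∷ [])
    · axI6 a α β · axI3 a α (◇ β) · axI7 a (¬' β)
    · re (tautology (~ ~ ~ x₀ ≡ₛ ~ x₀) _ (β ∷ [])) (in⇒ʳ (in¬ (in□ here)))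
    · axI3 a (◇ β) α
    · ⇒-congʳ (tautology ((x₀ ∨ₛ x₁) ≡ₛ (x₁ ∨ₛ x₀)) _ (◇ β ∷ α ∷ []))

  expressible-∨□ : {F χ : Fm V} → Expressible F → Expressible χ → Expressible (F ∨' □ χ)
  expressible-∨□ {F} {χ} (r , rL , e) (s , sL , f) =
    r ∨' s , InL-∨ rL sL , ↔-trans (⇒-split-□ F χ) (↔-cong-∨ e f)

  expressible-∨◇ : {F β : Fm V} → Expressible F → Expressible (¬' β) → Expressible (F ∨' ◇ β)
  expressible-∨◇ {F} {β} (r , rL , e) (s , sL , f) =
    r ∨' ¬' s , InL-∨ rL (L-¬ sL) , ↔-trans (⇒-split-◇ F β) (↔-cong-∨ e (re f (in¬ here)))

module Normalisation {V : Set} (a : Fm V) (aL : InL a) (p : V) where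
  open Antecedent a

  ⊥ₚ : Fm V
  ⊥ₚ = var p ∧' ¬' var p

  ⊥ₚ-nonmodal : Nonmodal ⊥ₚ
  ⊥ₚ-nonmodal = nm-∧ (nm-var p) (nm-¬ (nm-var p))

  expressible-nonmodal : {π : Fm V} → Nonmodal π → Expressible π
  expressible-nonmodal {π} nm = □ (a →' π) , L-□ (L-¬ (L-∧ aL (L-¬ (nonmodal-InL nm)))) , axI1 a π nm

  Reducible : Fm V → Set
  Reducible R = (π : Fm V) → Nonmodal π → Expressible (π ∨' R)

  ⊥ₚ-reducible : Reducible ⊥ₚ
  ⊥ₚ-reducible π nm = expressible-nonmodal (Nonmodal-∨ nm ⊥ₚ-nonmodal)

  mutual
    reducible-∨ : {c : Fm V} → InL c → (R : Fm V) → Reducible R → Reducible (c ∨' R)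
    reducible-∨ (L-var q) R K π nm =
      -- move the literal q into the nonmodal part
      expressible-cong (tautology ((x₀ ∨ₛ (x₁ ∨ₛ x₂)) ≡ₛ ((x₁ ∨ₛ x₀) ∨ₛ x₂)) _ (π ∷ var q ∷ R ∷ []))
        (K (var q ∨' π) (Nonmodal-∨ (nm-var q) nm))
    reducible-∨ (L-¬ h) R K π nm = reducible-¬∨ h R K π nm
    reducible-∨ {c ∧' d} (L-∧ h k) R K π nm =
      expressible-cong
        (tautology ((x₀ ∨ₛ ((x₁ & x₂) ∨ₛ x₃)) ≡ₛ ((x₀ ∨ₛ (x₁ ∨ₛ x₃)) & (x₀ ∨ₛ (x₂ ∨ₛ x₃)))) _
                   (π ∷ c ∷ d ∷ R ∷ []))
        (expressible-∧ (reducible-∨ h R K π nm) (reducible-∨ k R K π nm))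
    reducible-∨ {□ χ} (L-□ h) R K π nm =
      expressible-cong (tautology ((x₀ ∨ₛ (x₁ ∨ₛ x₂)) ≡ₛ ((x₀ ∨ₛ x₂) ∨ₛ x₁)) _ (π ∷ □ χ ∷ R ∷ []))
        (expressible-∨□ (K π nm) (expressible h))

    reducible-¬∨ : {c : Fm V} → InL c → (R : Fm V) → Reducible R → Reducible (¬' c ∨' R)
    reducible-¬∨ (L-var q) R K π nm =
      expressible-cong (tautology ((x₀ ∨ₛ (~ x₁ ∨ₛ x₂)) ≡ₛ ((~ x₁ ∨ₛ x₀) ∨ₛ x₂)) _ (π ∷ var q ∷ R ∷ []))
        (K (¬' var q ∨' π) (Nonmodal-∨ (nm-¬ (nm-var q)) nm))
    reducible-¬∨ {¬' c} (L-¬ h) R K π nm =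
      expressible-cong (tautology ((x₀ ∨ₛ (~ ~ x₁ ∨ₛ x₂)) ≡ₛ (x₀ ∨ₛ (x₁ ∨ₛ x₂))) _ (π ∷ c ∷ R ∷ []))
        (reducible-∨ h R K π nm)
    reducible-¬∨ {c ∧' d} (L-∧ h k) R K π nm =
      -- De Morgan: ¬(c ∧ d) ∨ R  ↔  ¬c ∨ (¬d ∨ R), handled residue by residue
      expressible-cong
        (tautology ((x₀ ∨ₛ (~ (x₁ & x₂) ∨ₛ x₃)) ≡ₛ (x₀ ∨ₛ (~ x₁ ∨ₛ (~ x₂ ∨ₛ x₃)))) _
                   (π ∷ c ∷ d ∷ R ∷ []))
        (reducible-¬∨ h (¬' d ∨' R) (reducible-¬∨ k R K) π nm)
    reducible-¬∨ {□ χ} (L-□ h) R K π nm =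
      -- ¬□χ is ◇¬χ up to replacing χ by ¬¬χ under the box
      expressible-cong
        (tautology ((x₂ ≡ₛ x₃) ⊃ ((x₀ ∨ₛ (~ x₂ ∨ₛ x₁)) ≡ₛ ((x₀ ∨ₛ x₁) ∨ₛ ~ x₃))) _
                   (π ∷ R ∷ □ χ ∷ □ ¬' ¬' χ ∷ [])
          · re (¬¬-intro χ) (in□ here))
        (expressible-∨◇ (K π nm) (expressible-cong (¬¬-elim χ) (expressible h)))

    -- χ ↔ ⊥ ∨ (χ ∨ ⊥), and ⊥ is a reducible residue.
    expressible : {χ : Fm V} → InL χ → Expressible χ
    expressible {χ} h =
      expressible-cong (tautology (x₀ ≡ₛ ((x₁ & ~ x₁) ∨ₛ (x₀ ∨ₛ (x₁ & ~ x₁)))) _ (χ ∷ var p ∷ []))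
        (reducible-∨ h ⊥ₚ ⊥ₚ-reducible ⊥ₚ ⊥ₚ-nonmodal)

lemma5 : {V : Set} (φ : Fm V) → Σ (Fm V) (λ φ' → InL φ' × (⊢Y (φ ↔' φ')))
lemma5 (var p) = var p , L-var p , ↔-refl (var p)
lemma5 (¬' φ) with lemma5 φ
... | φ' , l , e = ¬' φ' , L-¬ l , re e (in¬ here)
lemma5 (φ ∧' ψ) with lemma5 φ | lemma5 ψ
... | φ' , l , e | ψ' , l' , e' = φ' ∧' ψ' , L-∧ l l' , ↔-trans (re e (in∧ˡ here)) (re e' (in∧ʳ here))
lemma5 (□ φ) with lemma5 φ
... | φ' , l , e = □ φ' , L-□ l , re e (in□ here)
lemma5 (φ ⇒ ψ) with lemma5 φ | lemma5 ψ
... | φ' , l , e | ψ' , l' , e' with Normalisation.expressible φ' l (someVar ψ') l'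
... | r , rl , er = r , rl , ↔-trans (re e (in⇒ˡ here)) (↔-trans (re e' (in⇒ʳ here)) er)
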